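{- Let $k\in\mathbb{Z}^+$ and let $G_i=(V_i,E_i)$, $1\leq i\leq k$, be 3-balanced graphs with $V_i\cap V_j=\{v_0\}$ for $1\leq i<j\leq k$. Then $G=\left(\bigcup_{i=1}^kV_i,\ \bigcup_{i=1}^kE_i\right)$ is 3-balanced.
   Context: A graph is 3-balanced if it admits a vertex coloring $\ell:V\to\mathbb{Z}_3$ such that every vertex has, in its open neighborhood, the same number of vertices of each of the three colors. -}

module Defs where

open import Data.Nat using (ℕ)
open import Data.Bool using (Bool; true; false; _∧_; if_then_else_)
open import Data.Fin using (Fin; _≟_)
open import Data.List using (List; map)
open import Data.Nat.ListAction using (sum)
open import Data.Bool.ListAction using (any)
open import Data.Product using (Σ; _×_)
open import Relation.Nullary using (does)
open import Relation.Binary.PropositionalEquality using (_≡_)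
open import Data.List.Base using () renaming (allFin to allFinL)

record IsGraph {N : ℕ} (V : Fin N → Bool) (adj : Fin N → Fin N → Bool) : Set where
  field
    adj-sym    : ∀ u v → adj u v ≡ adj v u
    adj-irrefl : ∀ v → adj v v ≡ false
    adj-closed : ∀ u v → adj u v ≡ true → V u ≡ true

nbrCount : {N : ℕ} → (Fin N → Fin N → Bool) → (Fin N → Fin 3) → Fin N → Fin 3 → ℕ
nbrCount {N} adj ℓ v c =
  sum (map (λ u → if adj v u ∧ does (ℓ u ≟ c) then 1 else 0) (allFinL N))

ThreeBalanced : {N : ℕ} → (Fin N → Bool) → (Fin N → Fin N → Bool) → Set
ThreeBalanced {N} V adj =
  Σ (Fin N → Fin 3) λ ℓ →
    ∀ v → V v ≡ true → ∀ c c' → nbrCount adj ℓ v c ≡ nbrCount adj ℓ v c'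

unionV : {N k : ℕ} → (Fin k → Fin N → Bool) → Fin N → Bool
unionV {N} {k} Vs v = any (λ i → Vs i v) (allFinL k)

unionAdj : {N k : ℕ} → (Fin k → Fin N → Fin N → Bool) → Fin N → Fin N → Bool
unionAdj {N} {k} adjs u v = any (λ i → adjs i u v) (allFinL k)

{-# OPTIONS --safe #-}
-- Relabel the colours of each ℓᵢ by a permutation of ℤ₃ so that ℓᵢ(v₀) = 0;
-- a permutation of the colours preserves balance. The relabelled colourings
-- agree on the only shared vertex v₀, so they glue to a colouring ℓ of G.
-- Two of the graphs cannot share an edge, since its ends would both be v₀
-- and the graphs have no loops; hence the number of neighbours of colour c
-- of a vertex in G is the sum of these numbers in the Gᵢ, each of which is
-- independent of c (a vertex outside Vᵢ has no neighbours in Gᵢ at all).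
-- The theorem follows by induction on k from the case of two graphs.
module Submission where

open import Defs
open import Data.Nat using (ℕ; zero; suc; _+_; s<s; z<s)
open import Data.Nat.Properties using (+-commutativeSemigroup)
open import Algebra.Properties.CommutativeSemigroup +-commutativeSemigroup using (interchange)
open import Data.Nat.ListAction using (sum)
open import Data.Bool using (Bool; true; false; _∧_; _∨_; if_then_else_)
open import Data.Bool.Properties using (∨-zeroʳ; T-≡)
open import Data.Bool.ListAction using (any; or)
open import Data.Fin using (Fin; zero; suc; _<_; _≟_)
open import Data.Fin.Permutation using (Permutation; _⟨$⟩ʳ_; _⟨$⟩ˡ_; inverseˡ; inverseʳ; transpose)
open import Data.List using (List; []; _∷_; map; allFin)
open import Data.List.Properties using (map-cong; map-tabulate)
open import Data.List.Relation.Unary.Any using (satisfied)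
open import Data.List.Relation.Unary.Any.Properties using (any⁻)
open import Data.Product using (Σ; _×_; _,_; proj₁)
open import Function using (_∘_; id; case_of_; _⇔_; mk⇔; Equivalence)
open import Relation.Nullary using (does)
open import Relation.Nullary.Decidable using (dec-true; does-⇔)
open import Relation.Binary.PropositionalEquality
  using (_≡_; refl; sym; trans; cong; cong₂; subst; module ≡-Reasoning)

private variable
  N k : ℕ
  v₀ : Fin N
  V V′ V₁ V₂ : Fin N → Bool
  adj adj′ adj₁ adj₂ : Fin N → Fin N → Bool
  ℓ ℓ′ : Fin N → Fin 3

infixr 6 _∪_ _∪ₑ_

_∪_ : (Fin N → Bool) → (Fin N → Bool) → Fin N → Bool
(V₁ ∪ V₂) v = V₁ v ∨ V₂ v

_∪ₑ_ : (Fin N → Fin N → Bool) → (Fin N → Fin N → Bool) → Fin N → Fin N → Bool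
(adj₁ ∪ₑ adj₂) u v = adj₁ u v ∨ adj₂ u v

-- A record rather than a Π-type, so that adj, ℓ and v can be inferred from it.
record BalancedAt (adj : Fin N → Fin N → Bool) (ℓ : Fin N → Fin 3) (v : Fin N) : Set where
  constructor balancedAt
  field counts-equal : ∀ c c′ → nbrCount adj ℓ v c ≡ nbrCount adj ℓ v c′

open BalancedAt

indicator : Bool → ℕ
indicator b = if b then 1 else 0

-- nbrCount adj ℓ v c unfolds to countTrue (λ u → adj v u ∧ does (ℓ u ≟ c)).
countTrue : (Fin N → Bool) → ℕ
countTrue {N} p = sum (map (indicator ∘ p) (allFin N))

countTrue-cong : ∀ {p q : Fin N → Bool} → (∀ u → p u ≡ q u) → countTrue p ≡ countTrue q
countTrue-cong {N} e = cong sum (map-cong (cong indicator ∘ e) (allFin N))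

indicator-∨ : ∀ a b d → (a ∧ b) ≡ false →
  indicator ((a ∨ b) ∧ d) ≡ indicator (a ∧ d) + indicator (b ∧ d)
indicator-∨ false b     d     _ = refl
indicator-∨ true  false false _ = refl
indicator-∨ true  false true  _ = refl

sum-map-+ : ∀ {A : Set} (f g : A → ℕ) (xs : List A) →
  sum (map (λ x → f x + g x) xs) ≡ sum (map f xs) + sum (map g xs)
sum-map-+ f g []       = refl
sum-map-+ f g (x ∷ xs) =
  trans (cong (f x + g x +_) (sum-map-+ f g xs)) (interchange (f x) (g x) _ _)

balancedAt-∪ₑ : ∀ {v} → (∀ u → (adj₁ v u ∧ adj₂ v u) ≡ false) →
  BalancedAt adj₁ ℓ v → BalancedAt adj₂ ℓ v → BalancedAt (adj₁ ∪ₑ adj₂) ℓ v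
balancedAt-∪ₑ {N} {adj₁} {adj₂} {ℓ} {v} disjoint bal₁ bal₂ = balancedAt λ c c′ → begin
  nbrCount (adj₁ ∪ₑ adj₂) ℓ v c                ≡⟨ split c ⟩
  nbrCount adj₁ ℓ v c + nbrCount adj₂ ℓ v c    ≡⟨ cong₂ _+_ (counts-equal bal₁ c c′) (counts-equal bal₂ c c′) ⟩
  nbrCount adj₁ ℓ v c′ + nbrCount adj₂ ℓ v c′  ≡⟨ split c′ ⟨
  nbrCount (adj₁ ∪ₑ adj₂) ℓ v c′               ∎
  where
  open ≡-Reasoning
  split : ∀ c → nbrCount (adj₁ ∪ₑ adj₂) ℓ v c ≡ nbrCount adj₁ ℓ v c + nbrCount adj₂ ℓ v c
  split c = trans (cong sum (map-cong pointwise (allFin N))) (sum-map-+ _ _ (allFin N))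
    where
    pointwise : ∀ u → indicator ((adj₁ v u ∨ adj₂ v u) ∧ does (ℓ u ≟ c))
                    ≡ indicator (adj₁ v u ∧ does (ℓ u ≟ c)) + indicator (adj₂ v u ∧ does (ℓ u ≟ c))
    pointwise u = indicator-∨ (adj₁ v u) (adj₂ v u) _ (disjoint u)

balancedAt-permute : ∀ (π : Permutation 3 3) {v} →
  BalancedAt adj ℓ v → BalancedAt adj (λ u → π ⟨$⟩ʳ ℓ u) v
balancedAt-permute {adj = adj} {ℓ} π {v} bal = balancedAt λ c c′ →
  trans (permuted c) (trans (counts-equal bal _ _) (sym (permuted c′)))
  where
  image⇔preimage : ∀ {x c} → π ⟨$⟩ʳ x ≡ c ⇔ x ≡ π ⟨$⟩ˡ c
  image⇔preimage = mk⇔ (λ p → trans (sym (inverseˡ π)) (cong (π ⟨$⟩ˡ_) p))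
                       (λ p → trans (cong (π ⟨$⟩ʳ_) p) (inverseʳ π))
  permuted : ∀ c → nbrCount adj (λ u → π ⟨$⟩ʳ ℓ u) v c ≡ nbrCount adj ℓ v (π ⟨$⟩ˡ c)
  permuted c = countTrue-cong λ u →
    cong (adj v u ∧_) (does-⇔ image⇔preimage (π ⟨$⟩ʳ ℓ u ≟ c) (ℓ u ≟ π ⟨$⟩ˡ c))

transpose-sends : ∀ {n} (a b : Fin n) → transpose a b ⟨$⟩ʳ a ≡ b
transpose-sends a b rewrite dec-true (a ≟ a) refl = refl

threeBalanced-normalised : ∀ (v₀ : Fin N) → ThreeBalanced V adj →
  Σ (Fin N → Fin 3) λ ℓ → (∀ v → V v ≡ true → BalancedAt adj ℓ v) × ℓ v₀ ≡ zero
threeBalanced-normalised v₀ (ℓ , bal) =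
  (λ u → π ⟨$⟩ʳ ℓ u) , (λ v v∈V → balancedAt-permute {ℓ = ℓ} π (balancedAt (bal v v∈V))) ,
  transpose-sends (ℓ v₀) zero
  where
  π : Permutation 3 3
  π = transpose (ℓ v₀) zero

module _ (G : IsGraph V adj) where
  open IsGraph G

  adj-closedʳ : ∀ u v → adj u v ≡ true → V v ≡ true
  adj-closedʳ u v e = adj-closed v u (trans (adj-sym v u) e)

  adj-outside : ∀ {v} → V v ≡ false → ∀ u → adj v u ≡ false
  adj-outside {v} v∉V u with adj v u in e
  ... | false = refl
  ... | true with trans (sym v∉V) (adj-closed v u e)
  ... | ()

  balancedAt-agree : (∀ u → V u ≡ true → ℓ u ≡ ℓ′ u) →
    ∀ {v} → BalancedAt adj ℓ′ v → BalancedAt adj ℓ v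
  balancedAt-agree {ℓ} {ℓ′} agree {v} bal = balancedAt λ c c′ →
    trans (countTrue-cong (recolour c)) (trans (counts-equal bal c c′) (countTrue-cong (sym ∘ recolour c′)))
    where
    recolour : ∀ c u → (adj v u ∧ does (ℓ u ≟ c)) ≡ (adj v u ∧ does (ℓ′ u ≟ c))
    recolour c u with adj v u in e
    ... | false = refl
    ... | true  = cong (λ x → does (x ≟ c)) (agree u (adj-closedʳ v u e))

  balanced-everywhere : (∀ v → V v ≡ true → BalancedAt adj ℓ v) → ∀ v → BalancedAt adj ℓ v
  balanced-everywhere {ℓ} bal v with V v in e
  ... | true  = bal v e
  ... | false = balancedAt λ c c′ → countTrue-cong λ u →
    trans (cong (_∧ does (ℓ u ≟ c)) (adj-outside e u)) (sym (cong (_∧ does (ℓ u ≟ c′)) (adj-outside e u)))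

∪-isGraph : IsGraph V₁ adj₁ → IsGraph V₂ adj₂ → IsGraph (V₁ ∪ V₂) (adj₁ ∪ₑ adj₂)
∪-isGraph {V₁ = V₁} {adj₁} {V₂} {adj₂} G₁ G₂ = record
  { adj-sym    = λ u v → cong₂ _∨_ (adj-sym G₁ u v) (adj-sym G₂ u v)
  ; adj-irrefl = λ v → cong₂ _∨_ (adj-irrefl G₁ v) (adj-irrefl G₂ v)
  ; adj-closed = closed
  }
  where
  open IsGraph
  closed : ∀ u v → (adj₁ u v ∨ adj₂ u v) ≡ true → (V₁ u ∨ V₂ u) ≡ true
  closed u v e with adj₁ u v in e₁
  ... | true  = cong (_∨ V₂ u) (adj-closed G₁ u v e₁)
  ... | false = trans (cong (V₁ u ∨_) (adj-closed G₂ u v e)) (∨-zeroʳ (V₁ u))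

edge-disjoint : IsGraph V₁ adj₁ → IsGraph V₂ adj₂ →
  (∀ v → (V₁ v ∧ V₂ v) ≡ true → v ≡ v₀) → ∀ v u → (adj₁ v u ∧ adj₂ v u) ≡ false
edge-disjoint {adj₁ = adj₁} {adj₂ = adj₂} G₁ G₂ meet v u with adj₁ v u in e₁ | adj₂ v u in e₂
... | false | _     = refl
... | true  | false = refl
... | true  | true  = case trans (sym (subst (λ w → adj₁ v w ≡ true) u≡v e₁)) (IsGraph.adj-irrefl G₁ v) of λ ()
  where
  u≡v : u ≡ v
  u≡v = trans (meet u (cong₂ _∧_ (adj-closedʳ G₁ v u e₁) (adj-closedʳ G₂ v u e₂)))
              (sym (meet v (cong₂ _∧_ (IsGraph.adj-closed G₁ v u e₁) (IsGraph.adj-closed G₂ v u e₂))))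

∪-threeBalanced : IsGraph V₁ adj₁ → IsGraph V₂ adj₂ →
  (∀ v → (V₁ v ∧ V₂ v) ≡ true → v ≡ v₀) →
  ThreeBalanced V₁ adj₁ → ThreeBalanced V₂ adj₂ → ThreeBalanced (V₁ ∪ V₂) (adj₁ ∪ₑ adj₂)
∪-threeBalanced {V₁ = V₁} {adj₁} {V₂} {adj₂} {v₀} G₁ G₂ meet B₁ B₂
  with threeBalanced-normalised v₀ B₁ | threeBalanced-normalised v₀ B₂
... | ℓ₁ , bal₁ , ℓ₁v₀≡0 | ℓ₂ , bal₂ , ℓ₂v₀≡0 =
  glued , λ v _ → counts-equal (balancedAt-∪ₑ (edge-disjoint G₁ G₂ meet v) (glued-bal₁ v) (glued-bal₂ v))
  where
  glued : _ → Fin 3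
  glued u = if V₁ u then ℓ₁ u else ℓ₂ u

  glued≡ℓ₁ : ∀ u → V₁ u ≡ true → glued u ≡ ℓ₁ u
  glued≡ℓ₁ u u∈V₁ rewrite u∈V₁ = refl

  glued≡ℓ₂ : ∀ u → V₂ u ≡ true → glued u ≡ ℓ₂ u
  glued≡ℓ₂ u u∈V₂ with V₁ u in u∈V₁
  ... | false = refl
  ... | true  rewrite meet u (cong₂ _∧_ u∈V₁ u∈V₂) = trans ℓ₁v₀≡0 (sym ℓ₂v₀≡0)

  glued-bal₁ : ∀ v → BalancedAt adj₁ glued v
  glued-bal₁ = balanced-everywhere G₁ λ v v∈V₁ → balancedAt-agree G₁ glued≡ℓ₁ (bal₁ v v∈V₁)

  glued-bal₂ : ∀ v → BalancedAt adj₂ glued v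
  glued-bal₂ = balanced-everywhere G₂ λ v v∈V₂ → balancedAt-agree G₂ glued≡ℓ₂ (bal₂ v v∈V₂)

any-allFin-suc : ∀ (f : Fin (suc k) → Bool) → any f (allFin (suc k)) ≡ f zero ∨ any (f ∘ suc) (allFin k)
any-allFin-suc f =
  cong (λ bs → f zero ∨ or bs) (trans (map-tabulate suc f) (sym (map-tabulate id (f ∘ suc))))

any-allFin-true : ∀ (f : Fin k → Bool) → any f (allFin k) ≡ true → Σ (Fin k) λ i → f i ≡ true
any-allFin-true {k} f e with satisfied (any⁻ f (allFin k) (Equivalence.from T-≡ e))
... | i , fi = i , Equivalence.to T-≡ fi

IsGraph-cong : (∀ v → V v ≡ V′ v) → (∀ u v → adj u v ≡ adj′ u v) → IsGraph V adj → IsGraph V′ adj′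
IsGraph-cong eqV eqA G = record
  { adj-sym    = λ u v → trans (sym (eqA u v)) (trans (adj-sym u v) (eqA v u))
  ; adj-irrefl = λ v → trans (sym (eqA v v)) (adj-irrefl v)
  ; adj-closed = λ u v e → trans (sym (eqV u)) (adj-closed u v (trans (eqA u v) e))
  }
  where open IsGraph G

ThreeBalanced-cong : (∀ v → V v ≡ V′ v) → (∀ u v → adj u v ≡ adj′ u v) →
  ThreeBalanced V adj → ThreeBalanced V′ adj′
ThreeBalanced-cong eqV eqA (ℓ , bal) = ℓ , λ v v∈V′ c c′ →
  trans (countTrue-cong λ u → cong (_∧ does (ℓ u ≟ c)) (sym (eqA v u)))
        (trans (bal v (trans (eqV v) v∈V′) c c′)
               (countTrue-cong λ u → cong (_∧ does (ℓ u ≟ c′)) (eqA v u)))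

MeetOnlyAt : Fin N → (Fin k → Fin N → Bool) → Set
MeetOnlyAt v₀ Vs = ∀ i j → i < j → ∀ v → (Vs i v ∧ Vs j v) ≡ true → v ≡ v₀

union-isGraph : ∀ {k} (Vs : Fin k → Fin N → Bool) (adjs : Fin k → Fin N → Fin N → Bool) →
  (∀ i → IsGraph (Vs i) (adjs i)) → IsGraph (unionV Vs) (unionAdj adjs)
union-isGraph {k = zero} Vs adjs G = record
  { adj-sym = λ _ _ → refl ; adj-irrefl = λ _ → refl ; adj-closed = λ _ _ () }
union-isGraph {k = suc k} Vs adjs G =
  IsGraph-cong (λ v → sym (any-allFin-suc (λ i → Vs i v))) (λ u v → sym (any-allFin-suc (λ i → adjs i u v)))
    (∪-isGraph (G zero) (union-isGraph (Vs ∘ suc) (adjs ∘ suc) (G ∘ suc)))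

union-threeBalanced : ∀ {k} {v₀ : Fin N} (Vs : Fin k → Fin N → Bool) (adjs : Fin k → Fin N → Fin N → Bool) →
  (∀ i → IsGraph (Vs i) (adjs i)) → (∀ i → ThreeBalanced (Vs i) (adjs i)) →
  MeetOnlyAt v₀ Vs → ThreeBalanced (unionV Vs) (unionAdj adjs)
union-threeBalanced {k = zero} Vs adjs G B meet = (λ _ → zero) , λ _ ()
union-threeBalanced {k = suc k} {v₀} Vs adjs G B meet =
  ThreeBalanced-cong (λ v → sym (any-allFin-suc (λ i → Vs i v))) (λ u v → sym (any-allFin-suc (λ i → adjs i u v)))
    (∪-threeBalanced (G zero) (union-isGraph (Vs ∘ suc) (adjs ∘ suc) (G ∘ suc)) meet-rest
      (B zero) (union-threeBalanced (Vs ∘ suc) (adjs ∘ suc) (G ∘ suc) (B ∘ suc) λ i j i<j → meet (suc i) (suc j) (s<s i<j)))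
  where
  meet-rest : ∀ v → (Vs zero v ∧ unionV (Vs ∘ suc) v) ≡ true → v ≡ v₀
  meet-rest v e with Vs zero v in v∈V₀
  meet-rest v () | false
  ... | true with any-allFin-true (λ i → Vs (suc i) v) e
  ... | j , v∈Vⱼ = meet zero (suc j) z<s v (cong₂ _∧_ v∈V₀ v∈Vⱼ)

theorem6p3 : (N k' : ℕ) → let k = suc k' in
    (Vs : Fin k → Fin N → Bool) → (adjs : Fin k → Fin N → Fin N → Bool) →
    (v₀ : Fin N) →
    (∀ i → IsGraph (Vs i) (adjs i)) →
    (∀ i → ThreeBalanced (Vs i) (adjs i)) →
    (∀ (i j : Fin k) → i < j → ∀ v →
      ((Vs i v ∧ Vs j v) ≡ true → v ≡ v₀) × (v ≡ v₀ → (Vs i v ∧ Vs j v) ≡ true)) →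
    ThreeBalanced (unionV Vs) (unionAdj adjs)
theorem6p3 N k' Vs adjs v₀ G B intersections =
  union-threeBalanced Vs adjs G B λ i j i<j v → proj₁ (intersections i j i<j v)
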